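{- Let $\vec{\mathbf{d}}$ be a switch-irreducible directed degree sequence and let $G\in\Omega(\vec{\mathbf{d}})$ contain a set $U=\{v_0,v_1,v_2\}$ of three vertices such that the induced subdigraph $G[U]$ is a directed 3-cycle. Then there exists a useful neighbour or a useful arc for this 3-cycle.
   Context: $\Omega(\vec{\mathbf{d}})$ is the set of digraphs (no loops, no repeated arcs) on $[n]$ with in-degrees $d_j^-$ and out-degrees $d_j^+$. The directed switch chain on $\Omega(\vec{\mathbf{d}})$: from $G$ choose uniformly an unordered pair of distinct arcs $\{(i,j),(k,\ell)\}$; if $i,j,k,\ell$ are distinct and neither $(i,\ell)$ nor $(k,j)$ is an arc of $G$, replace $(i,j),(k,\ell)$ by $(i,\ell),(k,j)$; else stay. $\vec{\mathbf{d}}$ is switch-irreducible if this chain is irreducible. For $x$ a vertex, $(x,U)$ is the set of pairs $(x,u)$, $u\in U$, and $(U,x)$ similarly; $A(G)$ is the arc set and $A(G)^c$ the set of non-arcs. Define, for $x\in[n]\setminus U$: $U^0$: all of $(x,U)\cup(U,x)$ are non-arcs; $U^-$: $(x,U)\subseteq A(G)$ and $(U,x)\subseteq A(G)^c$; $U^+$: $(x,U)\subseteq A(G)^c$ and $(U,x)\subseteq A(G)$; $U^{\pm}$: $(x,U)\cup(U,x)\subseteq A(G)$. A vertex $x\notin U$ is a useful neighbour if $x\notin U^0\cup U^-\cup U^+\cup U^{\pm}$. A pair $(x,y)$ of distinct vertices is a useful arc if either $(x,y)\in A(G)$ with $x\in U^0\cup U^+$ and $y\in U^0\cup U^-$, or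 $(x,y)\notin A(G)$ with $x\in U^-\cup U^{\pm}$ and $y\in U^+\cup U^{\pm}$. -}

module Defs where

open import Data.Nat using (ℕ)
open import Data.Bool using (Bool; true; false; if_then_else_; _∧_; _∨_)
open import Data.Fin using (Fin; _≟_)
open import Data.List using (List; length; filter)
open import Data.List using () renaming (allFin to allFinL)
open import Data.Product using (Σ; ∃; _×_; _,_)
open import Data.Sum using (_⊎_)
open import Relation.Nullary using (¬_; ⌊_⌋)
open import Relation.Binary.PropositionalEquality using (_≡_; _≢_)
open import Relation.Binary.Construct.Closure.ReflexiveTransitive using (Star)

-- A digraph on [n] = Fin n: adjacency (arc) relation as a Boolean matrix,
-- with no loops.  Repeated arcs are impossible in this representation.
record Digraph (n : ℕ) : Set where
  field
    adj     : Fin n → Fin n → Bool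
    noLoops : ∀ i → adj i i ≡ false
open Digraph public

Arc : ∀ {n} → Digraph n → Fin n → Fin n → Set
Arc G x y = adj G x y ≡ true

NonArc : ∀ {n} → Digraph n → Fin n → Fin n → Set
NonArc G x y = adj G x y ≡ false

outdeg : ∀ {n} → Digraph n → Fin n → ℕ
outdeg {n} G x = length (filter (λ y → T? (adj G x y)) (allFinL n))
  where open import Data.Bool.Properties using (T?)

indeg : ∀ {n} → Digraph n → Fin n → ℕ
indeg {n} G y = length (filter (λ x → T? (adj G x y)) (allFinL n))
  where open import Data.Bool.Properties using (T?)

InΩ : ∀ {n} → (d⁻ d⁺ : Fin n → ℕ) → Digraph n → Set
InΩ d⁻ d⁺ G = ∀ v → indeg G v ≡ d⁻ v × outdeg G v ≡ d⁺ v

eqPair : ∀ {n} → Fin n → Fin n → Fin n → Fin n → Bool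
eqPair a b c d = ⌊ a ≟ c ⌋ ∧ ⌊ b ≟ d ⌋

switchAdj : ∀ {n} → Digraph n → (i j k l : Fin n) → Fin n → Fin n → Bool
switchAdj G i j k l a b =
  if eqPair a b i j ∨ eqPair a b k l then false
  else if eqPair a b i l ∨ eqPair a b k j then true
  else adj G a b

Distinct4 : ∀ {n} → Fin n → Fin n → Fin n → Fin n → Set
Distinct4 i j k l = i ≢ j × i ≢ k × i ≢ l × j ≢ k × j ≢ l × k ≢ l

Switch : ∀ {n} → Digraph n → Digraph n → Set
Switch {n} G H = Σ (Fin n) λ i → Σ (Fin n) λ j → Σ (Fin n) λ k → Σ (Fin n) λ l →
  Distinct4 i j k l × Arc G i j × Arc G k l × NonArc G i l × NonArc G k j ×
  (∀ a b → adj H a b ≡ switchAdj G i j k l a b)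

SwitchIrreducible : ∀ {n} → (d⁻ d⁺ : Fin n → ℕ) → Set
SwitchIrreducible {n} d⁻ d⁺ = ∀ (G H : Digraph n) → InΩ d⁻ d⁺ G → InΩ d⁻ d⁺ H → Star Switch G H

module ThreeCycle {n : ℕ} (G : Digraph n) (v₀ v₁ v₂ : Fin n) where

  InU : Fin n → Set
  InU x = x ≡ v₀ ⊎ x ≡ v₁ ⊎ x ≡ v₂

  U⁰ : Fin n → Set
  U⁰ x = ¬ InU x × (∀ u → InU u → NonArc G x u × NonArc G u x)

  U⁻ : Fin n → Set
  U⁻ x = ¬ InU x × (∀ u → InU u → Arc G x u × NonArc G u x)

  U⁺ : Fin n → Set
  U⁺ x = ¬ InU x × (∀ u → InU u → NonArc G x u × Arc G u x)

  U± : Fin n → Set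
  U± x = ¬ InU x × (∀ u → InU u → Arc G x u × Arc G u x)

  UsefulNeighbour : Fin n → Set
  UsefulNeighbour x = ¬ InU x × ¬ U⁰ x × ¬ U⁻ x × ¬ U⁺ x × ¬ U± x

  UsefulArc : Fin n → Fin n → Set
  UsefulArc x y = x ≢ y ×
    ((Arc G x y × (U⁰ x ⊎ U⁺ x) × (U⁰ y ⊎ U⁻ y)) ⊎
     (NonArc G x y × (U⁻ x ⊎ U± x) × (U⁺ y ⊎ U± y)))

IsDirected3Cycle : ∀ {n} → Digraph n → Fin n → Fin n → Fin n → Set
IsDirected3Cycle G v₀ v₁ v₂ =
  v₀ ≢ v₁ × v₁ ≢ v₂ × v₀ ≢ v₂ ×
  Arc G v₀ v₁ × Arc G v₁ v₂ × Arc G v₂ v₀ ×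
  NonArc G v₁ v₀ × NonArc G v₂ v₁ × NonArc G v₀ v₂

-- Suppose the 3-cycle U has neither a useful neighbour nor a useful arc. Then
-- every vertex x outside U is joined to all of U in the same way, recorded by
-- its kind (x → U?, U → x?), and for outside vertices a, b with (a → U) equal
-- to (U → b), the pair (a, b) is an arc exactly when a → U, since otherwise it
-- would be a useful arc. Call these adjacencies, together with all those that
-- involve U, forced. A finite check over the seven kinds shows that no switch
-- changes a forced pair, so every digraph switch-reachable from G has the same
-- forced adjacencies, in particular the same orientation of U. But reversing
-- the cycle preserves all degrees, so by irreducibility the reversed digraph
-- would be reachable from G.
module Submission where

open import Defs
open import Level using (0ℓ)
open import Data.Nat using (ℕ; zero; suc)
open import Data.Bool using (Bool; true; false)
open import Data.Bool.Properties using (T?; ¬-not) renaming (_≟_ to _≟ᵇ_)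
open import Data.Fin using (Fin; zero; suc)
open import Data.Fin.Properties using (_≟_; any?)
open import Data.Fin.Permutation as Perm using (Permutation′; _⟨$⟩ʳ_; transpose)
open import Data.List using (List; []; _∷_; length; filter; tabulate; allFin)
open import Data.List.Membership.Propositional using (_∈_)
open import Data.List.Relation.Unary.Any using (here; there)
open import Data.List.Relation.Unary.All as All using (all?)
open import Data.Maybe using (Maybe; just; nothing)
open import Data.Maybe.Properties using (≡-dec)
open import Data.Maybe.Relation.Unary.All as Maybe using (just; nothing; drop-just)
open import Data.Nat.Properties using (+-0-commutativeMonoid)
open import Algebra.Properties.CommutativeMonoid.Sum +-0-commutativeMonoid
  using (sum; sum-permute; sum-cong-≗)
open import Data.Product using (∃; ∃₂; _×_; _,_; proj₁; proj₂)
open import Data.Sum using (_⊎_; inj₁; inj₂; [_,_]′)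
open import Data.Empty using (⊥-elim)
open import Function using (_∘_; id)
open import Relation.Nullary using (¬_; Dec; yes; no)
open import Relation.Nullary.Decidable
  using (_×-dec_; _⊎-dec_; _→-dec_; ¬?; map′; from-yes; decidable-stable)
open import Relation.Unary using (Pred; Decidable)
open import Relation.Binary.PropositionalEquality
open import Relation.Binary.Construct.Closure.ReflexiveTransitive using (Star; fold)

indicator : Bool → ℕ
indicator true  = 1
indicator false = 0

countTrue : ∀ {n} → (Fin n → Bool) → ℕ
countTrue {n} f = length (filter (T? ∘ f) (allFin n))

countTrue-tabulate : ∀ {m} n (f : Fin m → Bool) (g : Fin n → Fin m) →
  length (filter (T? ∘ f) (tabulate g)) ≡ sum (indicator ∘ f ∘ g)
countTrue-tabulate zero    f g = refl
countTrue-tabulate (suc n) f g with f (g zero)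
... | true  = cong suc (countTrue-tabulate n f (g ∘ suc))
... | false = countTrue-tabulate n f (g ∘ suc)

countTrue-permute : ∀ {n} (f g : Fin n → Bool) (π : Permutation′ n) →
  (∀ y → g y ≡ f (π ⟨$⟩ʳ y)) → countTrue g ≡ countTrue f
countTrue-permute {n} f g π g≗fπ = begin
  countTrue g                        ≡⟨ countTrue-tabulate n g id ⟩
  sum (indicator ∘ g)                ≡⟨ sum-cong-≗ (cong indicator ∘ g≗fπ) ⟩
  sum (indicator ∘ f ∘ (π ⟨$⟩ʳ_))    ≡⟨ sum-permute (indicator ∘ f) π ⟨
  sum (indicator ∘ f)                ≡⟨ countTrue-tabulate n f id ⟨
  countTrue f                        ∎
  where open ≡-Reasoning

transpose-matchˡ : ∀ {n} (i j : Fin n) → transpose i j ⟨$⟩ʳ i ≡ j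
transpose-matchˡ i j with i ≟ i
... | yes _   = refl
... | no i≢i = ⊥-elim (i≢i refl)

transpose-matchʳ : ∀ {n} (i j : Fin n) → transpose i j ⟨$⟩ʳ j ≡ i
transpose-matchʳ i j with j ≟ i
... | yes j≡i = j≡i
... | no _ with j ≟ j
...   | yes _   = refl
...   | no j≢j = ⊥-elim (j≢j refl)

transpose-other : ∀ {n} {i j k : Fin n} → k ≢ i → k ≢ j → transpose i j ⟨$⟩ʳ k ≡ k
transpose-other {i = i} {j} {k} k≢i k≢j with k ≟ i
... | yes k≡i = ⊥-elim (k≢i k≡i)
... | no _ with k ≟ j
...   | yes k≡j = ⊥-elim (k≢j k≡j)
...   | no _    = refl

eqPair-false : ∀ {n} {a b x y : Fin n} → ¬ (a ≡ x × b ≡ y) → eqPair a b x y ≡ false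
eqPair-false {a = a} {b} {x} {y} ¬same with a ≟ x | b ≟ y
... | yes refl | yes refl = ⊥-elim (¬same (refl , refl))
... | yes _    | no _     = refl
... | no _     | _        = refl

switchAdj-elsewhere : ∀ {n} (H : Digraph n) {i j k l a b : Fin n} →
  eqPair a b i j ≡ false → eqPair a b k l ≡ false →
  eqPair a b i l ≡ false → eqPair a b k j ≡ false →
  switchAdj H i j k l a b ≡ adj H a b
switchAdj-elsewhere H ij kl il kj rewrite ij | kl | il | kj = refl

-- outside p q: a vertex outside U that sends arcs to all of U if p, to none if
-- not p, and receives arcs from all of U if q, from none if not q.
data Kind : Set where
  corner₀ corner₁ corner₂ : Kind
  outside : Bool → Bool → Kind

common : Bool → Bool → Maybe Bool
common true  true  = just true
common false false = just false
common _     _     = nothing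

-- The adjacency a pair of vertices of these kinds must have, if determined;
-- cornerᵢ stands for vᵢ of the cycle v₀ → v₁ → v₂ → v₀.
forced : Kind → Kind → Maybe Bool
forced corner₀       corner₁       = just true
forced corner₁       corner₂       = just true
forced corner₂       corner₀       = just true
forced (outside p _) (outside _ q) = common p q
forced (outside p _) _             = just p
forced _             (outside _ q) = just q
forced _             _             = just false

Agrees : Maybe Bool → Bool → Set
Agrees m b = Maybe.All (b ≡_) m

agrees? : ∀ m b → Dec (Agrees m b)
agrees? m b = Maybe.dec (b ≟ᵇ_) m

common-agrees : ∀ p q {r} → (p ≡ q → r ≡ p) → Agrees (common p q) r
common-agrees true  true  r≡p = just (r≡p refl)
common-agrees false false r≡p = just (r≡p refl)
common-agrees true  false _   = nothing
common-agrees false true  _   = nothing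

Unforced : Kind → Kind → Set
Unforced a b = forced a b ≡ nothing

unforced? : ∀ a b → Dec (Unforced a b)
unforced? a b = ≡-dec _≟ᵇ_ (forced a b) nothing

sameCorner : Kind → Kind → Bool
sameCorner corner₀ corner₀ = true
sameCorner corner₁ corner₁ = true
sameCorner corner₂ corner₂ = true
sameCorner _       _       = false

Apart : Kind → Kind → Set
Apart a b = sameCorner a b ≡ false

-- The kinds of a switch (a,b),(c,d) ↦ (a,d),(c,b) in a digraph realising
-- the forced adjacencies.
SwitchShape : Kind → Kind → Kind → Kind → Set
SwitchShape a b c d =
  Apart a d × Apart c b ×
  Agrees (forced a b) true × Agrees (forced c d) true ×
  Agrees (forced a d) false × Agrees (forced c b) false

switchShape? : ∀ a b c d → Dec (SwitchShape a b c d)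
switchShape? a b c d =
  (sameCorner a d ≟ᵇ false) ×-dec (sameCorner c b ≟ᵇ false) ×-dec
  agrees? (forced a b) true ×-dec agrees? (forced c d) true ×-dec
  agrees? (forced a d) false ×-dec agrees? (forced c b) false

kinds : List Kind
kinds = corner₀ ∷ corner₁ ∷ corner₂ ∷
        outside false false ∷ outside false true ∷ outside true false ∷ outside true true ∷ []

∈-kinds : ∀ k → k ∈ kinds
∈-kinds corner₀               = here refl
∈-kinds corner₁               = there (here refl)
∈-kinds corner₂               = there (there (here refl))
∈-kinds (outside false false) = there (there (there (here refl)))
∈-kinds (outside false true)  = there (there (there (there (here refl))))
∈-kinds (outside true false)  = there (there (there (there (there (here refl)))))
∈-kinds (outside true true)   = there (there (there (there (there (there (here refl))))))

∀-kind? : {P : Pred Kind 0ℓ} → Decidable P → Dec (∀ k → P k)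
∀-kind? P? = map′ (λ ps k → All.lookup ps (∈-kinds k)) (λ ps → All.tabulate λ {k} _ → ps k)
                  (all? P? kinds)

-- Decided by evaluation over all 7⁴ quadruples of kinds.
switch-unforced : ∀ a b c d → SwitchShape a b c d →
  Unforced a b × Unforced c d × Unforced a d × Unforced c b
switch-unforced = from-yes
  (∀-kind? λ a → ∀-kind? λ b → ∀-kind? λ c → ∀-kind? λ d →
     switchShape? a b c d →-dec
       (unforced? a b ×-dec unforced? c d ×-dec unforced? a d ×-dec unforced? c b))

module Triangle {n : ℕ} (G : Digraph n) (v₀ v₁ v₂ : Fin n)
  (v₀≢v₁ : v₀ ≢ v₁) (v₁≢v₂ : v₁ ≢ v₂) (v₀≢v₂ : v₀ ≢ v₂)
  (arc₀₁ : Arc G v₀ v₁) (arc₁₂ : Arc G v₁ v₂) (arc₂₀ : Arc G v₂ v₀)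
  (nonArc₁₀ : NonArc G v₁ v₀) (nonArc₂₁ : NonArc G v₂ v₁) (nonArc₀₂ : NonArc G v₀ v₂)
  where

  open ThreeCycle G v₀ v₁ v₂

  InU? : ∀ x → Dec (InU x)
  InU? x = (x ≟ v₀) ⊎-dec (x ≟ v₁) ⊎-dec (x ≟ v₂)

  data Position (x : Fin n) : Set where
    at₀ : x ≡ v₀ → Position x
    at₁ : x ≡ v₁ → Position x
    at₂ : x ≡ v₂ → Position x
    off : ¬ InU x → Position x

  position : ∀ x → Position x
  position x with x ≟ v₀ | x ≟ v₁ | x ≟ v₂
  ... | yes x≡v₀ | _        | _        = at₀ x≡v₀
  ... | no _     | yes x≡v₁ | _        = at₁ x≡v₁
  ... | no _     | no _     | yes x≡v₂ = at₂ x≡v₂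
  ... | no x≢v₀  | no x≢v₁  | no x≢v₂  = off [ x≢v₀ , [ x≢v₁ , x≢v₂ ]′ ]′

  position-v₀ : ∃ λ v₀≡v₀ → position v₀ ≡ at₀ v₀≡v₀
  position-v₀ with position v₀
  ... | at₀ e  = e , refl
  ... | at₁ e  = ⊥-elim (v₀≢v₁ e)
  ... | at₂ e  = ⊥-elim (v₀≢v₂ e)
  ... | off ∉U = ⊥-elim (∉U (inj₁ refl))

  position-v₁ : ∃ λ v₁≡v₁ → position v₁ ≡ at₁ v₁≡v₁
  position-v₁ with position v₁
  ... | at₀ e  = ⊥-elim (v₀≢v₁ (sym e))
  ... | at₁ e  = e , refl
  ... | at₂ e  = ⊥-elim (v₁≢v₂ e)
  ... | off ∉U = ⊥-elim (∉U (inj₂ (inj₁ refl)))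

  -- Reversal swaps, in the row and in the column of each cycle vertex, the
  -- entries of the two other cycle vertices.
  mirror : ∀ {x} → Position x → Permutation′ n
  mirror (at₀ _) = transpose v₁ v₂
  mirror (at₁ _) = transpose v₂ v₀
  mirror (at₂ _) = transpose v₀ v₁
  mirror (off _) = Perm.id

  mirror-self : ∀ {x} (p : Position x) → mirror p ⟨$⟩ʳ x ≡ x
  mirror-self (at₀ refl) = transpose-other v₀≢v₁ v₀≢v₂
  mirror-self (at₁ refl) = transpose-other v₁≢v₂ (v₀≢v₁ ∘ sym)
  mirror-self (at₂ refl) = transpose-other (v₀≢v₂ ∘ sym) (v₁≢v₂ ∘ sym)
  mirror-self (off _)    = refl

  mirror-off : ∀ {x y} (p : Position x) → ¬ InU y → mirror p ⟨$⟩ʳ y ≡ y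
  mirror-off (at₀ _) y∉U = transpose-other (y∉U ∘ inj₂ ∘ inj₁) (y∉U ∘ inj₂ ∘ inj₂)
  mirror-off (at₁ _) y∉U = transpose-other (y∉U ∘ inj₂ ∘ inj₂) (y∉U ∘ inj₁)
  mirror-off (at₂ _) y∉U = transpose-other (y∉U ∘ inj₁) (y∉U ∘ inj₂ ∘ inj₁)
  mirror-off (off _) _   = refl

  mirror-column : ∀ {v y} (p : Position v) (q : Position y) →
    adj G y (mirror q ⟨$⟩ʳ v) ≡ adj G (mirror p ⟨$⟩ʳ y) v
  mirror-column (off v∉U) q rewrite mirror-off q v∉U = refl
  mirror-column p (off y∉U) rewrite mirror-off p y∉U = refl
  mirror-column p@(at₀ refl) (at₀ refl) rewrite mirror-self p = refl
  mirror-column p@(at₁ refl) (at₁ refl) rewrite mirror-self p = refl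
  mirror-column p@(at₂ refl) (at₂ refl) rewrite mirror-self p = refl
  mirror-column (at₀ refl) (at₁ refl)
    rewrite transpose-matchʳ v₂ v₀ | transpose-matchˡ v₁ v₂ = trans arc₁₂ (sym arc₂₀)
  mirror-column (at₀ refl) (at₂ refl)
    rewrite transpose-matchˡ v₀ v₁ | transpose-matchʳ v₁ v₂ = trans nonArc₂₁ (sym nonArc₁₀)
  mirror-column (at₁ refl) (at₀ refl)
    rewrite transpose-matchˡ v₁ v₂ | transpose-matchʳ v₂ v₀ = trans nonArc₀₂ (sym nonArc₂₁)
  mirror-column (at₁ refl) (at₂ refl)
    rewrite transpose-matchʳ v₀ v₁ | transpose-matchˡ v₂ v₀ = trans arc₂₀ (sym arc₀₁)
  mirror-column (at₂ refl) (at₀ refl)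
    rewrite transpose-matchʳ v₁ v₂ | transpose-matchˡ v₀ v₁ = trans arc₀₁ (sym arc₁₂)
  mirror-column (at₂ refl) (at₁ refl)
    rewrite transpose-matchˡ v₂ v₀ | transpose-matchʳ v₀ v₁ = trans nonArc₁₀ (sym nonArc₀₂)

  reversed : Digraph n
  reversed = record
    { adj     = λ x y → adj G x (mirror (position x) ⟨$⟩ʳ y)
    ; noLoops = λ x → trans (cong (adj G x) (mirror-self (position x))) (noLoops G x)
    }

  reversed-InΩ : ∀ {d⁻ d⁺} → InΩ d⁻ d⁺ G → InΩ d⁻ d⁺ reversed
  reversed-InΩ G∈Ω v =
    trans (countTrue-permute (λ y → adj G y v) (λ y → adj reversed y v) (mirror (position v))
                             (λ y → mirror-column (position v) (position y)))
          (proj₁ (G∈Ω v)) ,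
    trans (countTrue-permute (adj G v) (adj reversed v) (mirror (position v)) (λ _ → refl))
          (proj₂ (G∈Ω v))

  reversed-arc₁₀ : Arc reversed v₁ v₀
  reversed-arc₁₀ rewrite proj₂ position-v₁ | transpose-matchʳ v₂ v₀ = arc₁₂

  record Uniform (x : Fin n) : Set where
    field
      out₁ : adj G x v₁ ≡ adj G x v₀
      out₂ : adj G x v₂ ≡ adj G x v₀
      in₁  : adj G v₁ x ≡ adj G v₀ x
      in₂  : adj G v₂ x ≡ adj G v₀ x
  open Uniform

  uniform? : ∀ x → Dec (Uniform x)
  uniform? x =
    map′ (λ (o₁ , o₂ , i₁ , i₂) → record { out₁ = o₁ ; out₂ = o₂ ; in₁ = i₁ ; in₂ = i₂ })
         (λ u → out₁ u , out₂ u , in₁ u , in₂ u)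
         ((adj G x v₁ ≟ᵇ adj G x v₀) ×-dec (adj G x v₂ ≟ᵇ adj G x v₀) ×-dec
          (adj G v₁ x ≟ᵇ adj G v₀ x) ×-dec (adj G v₂ x ≟ᵇ adj G v₀ x))

  SeesU : Fin n → Bool → Bool → Set
  SeesU x p q = ∀ u → InU u → adj G x u ≡ p × adj G u x ≡ q

  uniform-sees-U : ∀ {x} → Uniform x → SeesU x (adj G x v₀) (adj G v₀ x)
  uniform-sees-U u _ (inj₁ refl)        = refl , refl
  uniform-sees-U u _ (inj₂ (inj₁ refl)) = out₁ u , in₁ u
  uniform-sees-U u _ (inj₂ (inj₂ refl)) = out₂ u , in₂ u

  sees-U-uniform : ∀ {x p q} → SeesU x p q → Uniform x
  sees-U-uniform sees
    with sees v₀ (inj₁ refl) | sees v₁ (inj₂ (inj₁ refl)) | sees v₂ (inj₂ (inj₂ refl))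
  ... | o₀ , i₀ | o₁ , i₁ | o₂ , i₂ = record
    { out₁ = trans o₁ (sym o₀) ; out₂ = trans o₂ (sym o₀)
    ; in₁  = trans i₁ (sym i₀) ; in₂  = trans i₂ (sym i₀) }

  Class : Bool → Bool → Fin n → Set
  Class false false = U⁰
  Class true  false = U⁻
  Class false true  = U⁺
  Class true  true  = U±

  class-sees-U : ∀ {x} p q → Class p q x → SeesU x p q
  class-sees-U false false = proj₂
  class-sees-U true  false = proj₂
  class-sees-U false true  = proj₂
  class-sees-U true  true  = proj₂

  uniform-class : ∀ {x} → ¬ InU x → Uniform x → Class (adj G x v₀) (adj G v₀ x) x
  uniform-class {x} x∉U u = go (adj G x v₀) (adj G v₀ x) (uniform-sees-U u)
    where
      go : ∀ p q → SeesU x p q → Class p q x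
      go false false sees = x∉U , sees
      go true  false sees = x∉U , sees
      go false true  sees = x∉U , sees
      go true  true  sees = x∉U , sees

  nonUniform-useful : ∀ {x} → ¬ InU x → ¬ Uniform x → UsefulNeighbour x
  nonUniform-useful {x} x∉U ¬u =
    x∉U , ¬class false false , ¬class true false , ¬class false true , ¬class true true
    where
      ¬class : ∀ p q → ¬ Class p q x
      ¬class p q c = ¬u (sees-U-uniform (class-sees-U p q c))

  NonUniform : Fin n → Set
  NonUniform x = ¬ InU x × ¬ Uniform x

  nonUniform? : ∀ x → Dec (NonUniform x)
  nonUniform? x = ¬? (InU? x) ×-dec ¬? (uniform? x)

  uniform-outside : ¬ (∃ NonUniform) → ∀ x → ¬ InU x → Uniform x
  uniform-outside none x x∉U = decidable-stable (uniform? x) (λ ¬u → none (x , x∉U , ¬u))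

  Mismatched : Fin n → Fin n → Set
  Mismatched a b =
    ¬ InU a × ¬ InU b × a ≢ b × adj G a v₀ ≡ adj G v₀ b × adj G a b ≢ adj G a v₀

  mismatched? : ∀ a b → Dec (Mismatched a b)
  mismatched? a b =
    ¬? (InU? a) ×-dec ¬? (InU? b) ×-dec ¬? (a ≟ b) ×-dec
    (adj G a v₀ ≟ᵇ adj G v₀ b) ×-dec ¬? (adj G a b ≟ᵇ adj G a v₀)

  forget-in : ∀ {x} p q → Class p q x → Class p false x ⊎ Class p true x
  forget-in _ false = inj₁
  forget-in _ true  = inj₂

  forget-out : ∀ {x} p q → Class p q x → Class false q x ⊎ Class true q x
  forget-out false _ = inj₁
  forget-out true  _ = inj₂

  classes-usefulArc : ∀ {a b} p {qa pb} → a ≢ b → Class p qa a → Class pb p b →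
    adj G a b ≢ p → UsefulArc a b
  classes-usefulArc false {qa} {pb} a≢b ca cb ab≢p =
    a≢b , inj₁ (¬-not ab≢p , forget-in false qa ca , forget-out pb false cb)
  classes-usefulArc true  {qa} {pb} a≢b ca cb ab≢p =
    a≢b , inj₂ (¬-not ab≢p , forget-in true qa ca , forget-out pb true cb)

  mismatched-useful : (∀ x → ¬ InU x → Uniform x) →
    ∀ {a b} → Mismatched a b → UsefulArc a b
  mismatched-useful uniform {a} {b} (a∉U , b∉U , a≢b , same , ab≢) =
    classes-usefulArc (adj G a v₀) {adj G v₀ a} {adj G b v₀} a≢b
      (uniform-class a∉U (uniform a a∉U))
      (subst (λ q → Class (adj G b v₀) q b) (sym same) (uniform-class b∉U (uniform b b∉U)))
      ab≢

  kindAt : ∀ {x} → Position x → Kind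
  kindAt (at₀ _)     = corner₀
  kindAt (at₁ _)     = corner₁
  kindAt (at₂ _)     = corner₂
  kindAt {x} (off _) = outside (adj G x v₀) (adj G v₀ x)

  kind : Fin n → Kind
  kind x = kindAt (position x)

  kind-apart : ∀ {a b} → a ≢ b → Apart (kind a) (kind b)
  kind-apart {a} {b} a≢b = go (position a) (position b)
    where
      go : (p : Position a) (q : Position b) → Apart (kindAt p) (kindAt q)
      go (at₀ refl) (at₀ refl) = ⊥-elim (a≢b refl)
      go (at₁ refl) (at₁ refl) = ⊥-elim (a≢b refl)
      go (at₂ refl) (at₂ refl) = ⊥-elim (a≢b refl)
      go (at₀ _) (at₁ _) = refl
      go (at₀ _) (at₂ _) = refl
      go (at₀ _) (off _) = refl
      go (at₁ _) (at₀ _) = refl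
      go (at₁ _) (at₂ _) = refl
      go (at₁ _) (off _) = refl
      go (at₂ _) (at₀ _) = refl
      go (at₂ _) (at₁ _) = refl
      go (at₂ _) (off _) = refl
      go (off _) _       = refl

  Fixes : Digraph n → Set
  Fixes H = ∀ a b → a ≢ b → Agrees (forced (kind a) (kind b)) (adj H a b)

  G-fixes : (∀ x → ¬ InU x → Uniform x) → ¬ (∃₂ Mismatched) → Fixes G
  G-fixes uniform noMismatch a b a≢b = go (position a) (position b)
    where
      go : (p : Position a) (q : Position b) → Agrees (forced (kindAt p) (kindAt q)) (adj G a b)
      go (at₀ refl) (at₀ refl) = ⊥-elim (a≢b refl)
      go (at₁ refl) (at₁ refl) = ⊥-elim (a≢b refl)
      go (at₂ refl) (at₂ refl) = ⊥-elim (a≢b refl)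
      go (at₀ refl) (at₁ refl) = just arc₀₁
      go (at₀ refl) (at₂ refl) = just nonArc₀₂
      go (at₁ refl) (at₀ refl) = just nonArc₁₀
      go (at₁ refl) (at₂ refl) = just arc₁₂
      go (at₂ refl) (at₀ refl) = just arc₂₀
      go (at₂ refl) (at₁ refl) = just nonArc₂₁
      go (at₀ refl) (off _)    = just refl
      go (at₁ refl) (off b∉U)  = just (in₁ (uniform b b∉U))
      go (at₂ refl) (off b∉U)  = just (in₂ (uniform b b∉U))
      go (off _)    (at₀ refl) = just refl
      go (off a∉U)  (at₁ refl) = just (out₁ (uniform a a∉U))
      go (off a∉U)  (at₂ refl) = just (out₂ (uniform a a∉U))
      go (off a∉U)  (off b∉U)  =
        common-agrees (adj G a v₀) (adj G v₀ b) λ same →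
          decidable-stable (adj G a b ≟ᵇ adj G a v₀)
            (λ ab≢ → noMismatch (a , b , a∉U , b∉U , a≢b , same , ab≢))

  switch-fixes : ∀ {H H′} → Switch H H′ → Fixes H → Fixes H′
  switch-fixes {H} {H′} (i , j , k , l , (i≢j , _ , i≢l , j≢k , _ , k≢l) , ij , kl , il , kj , H′≡)
               fixes a b a≢b
    with forced (kind a) (kind b) in forced-ab
  ... | nothing = nothing
  ... | just c  = just (begin
      adj H′ a b               ≡⟨ H′≡ a b ⟩
      switchAdj H i j k l a b  ≡⟨ untouched (switch-unforced (kind i) (kind j) (kind k) (kind l) shape) ⟩
      adj H a b                ≡⟨ drop-just fixed-ab ⟩
      c                        ∎)
    where
      open ≡-Reasoning
      fixed-ab : Agrees (just c) (adj H a b)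
      fixed-ab = subst (λ m → Agrees m (adj H a b)) forced-ab (fixes a b a≢b)

      agrees : ∀ {x y β} → adj H x y ≡ β → x ≢ y → Agrees (forced (kind x) (kind y)) β
      agrees xy≡β x≢y = subst (Agrees _) xy≡β (fixes _ _ x≢y)

      shape : SwitchShape (kind i) (kind j) (kind k) (kind l)
      shape = kind-apart i≢l , kind-apart (j≢k ∘ sym) ,
              agrees ij i≢j , agrees kl k≢l , agrees il i≢l , agrees kj (j≢k ∘ sym)

      elsewhere : ∀ {x y} → Unforced (kind x) (kind y) → eqPair a b x y ≡ false
      elsewhere {x} {y} free =
        eqPair-false {a = a} {b} {x} {y} λ { (refl , refl) → just≢nothing (trans (sym forced-ab) free) }
        where
          just≢nothing : _≢_ {A = Maybe Bool} (just c) nothing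
          just≢nothing ()

      untouched : Unforced (kind i) (kind j) × Unforced (kind k) (kind l) ×
                  Unforced (kind i) (kind l) × Unforced (kind k) (kind j) →
                  switchAdj H i j k l a b ≡ adj H a b
      untouched (free-ij , free-kl , free-il , free-kj) =
        switchAdj-elsewhere H (elsewhere free-ij) (elsewhere free-kl) (elsewhere free-il) (elsewhere free-kj)

  reachable-fixes : ∀ {H H′} → Star Switch H H′ → Fixes H → Fixes H′
  reachable-fixes =
    fold (λ H H′ → Fixes H → Fixes H′) (λ {H} {H′} s k f → k (switch-fixes {H} {H′} s f)) (λ f → f)

  reversed-unfixed : ¬ Fixes reversed
  reversed-unfixed fixes = true≢false (drop-just agrees)
    where
      true≢false : true ≢ false
      true≢false ()
      agrees : Agrees (forced corner₁ corner₀) true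
      agrees = subst₂ (λ k k′ → Agrees (forced k k′) true)
        (cong kindAt (proj₂ position-v₁)) (cong kindAt (proj₂ position-v₀))
        (subst (Agrees _) reversed-arc₁₀ (fixes v₁ v₀ (v₀≢v₁ ∘ sym)))

  usefulNeighbourOrArc : ∀ {d⁻ d⁺} → SwitchIrreducible d⁻ d⁺ → InΩ d⁻ d⁺ G →
    (∃ λ x → UsefulNeighbour x) ⊎ (∃₂ λ x y → UsefulArc x y)
  usefulNeighbourOrArc irreducible G∈Ω with any? nonUniform?
  ... | yes (x , x∉U , ¬u) = inj₁ (x , nonUniform-useful x∉U ¬u)
  ... | no noNonUniform with any? (λ a → any? (mismatched? a))
  ...   | yes (a , b , m) = inj₂ (a , b , mismatched-useful (uniform-outside noNonUniform) m)
  ...   | no noMismatch = ⊥-elim (reversed-unfixed (reachable-fixes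
            (irreducible G reversed G∈Ω (reversed-InΩ G∈Ω))
            (G-fixes (uniform-outside noNonUniform) noMismatch)))

lemma3p2 : ∀ {n : ℕ} (d⁻ d⁺ : Fin n → ℕ) → SwitchIrreducible d⁻ d⁺ →
    (G : Digraph n) → InΩ d⁻ d⁺ G →
    (v₀ v₁ v₂ : Fin n) → IsDirected3Cycle G v₀ v₁ v₂ →
    (∃ λ x → ThreeCycle.UsefulNeighbour G v₀ v₁ v₂ x) ⊎
    (∃₂ λ x y → ThreeCycle.UsefulArc G v₀ v₁ v₂ x y)
lemma3p2 d⁻ d⁺ irreducible G G∈Ω v₀ v₁ v₂ (v₀≢v₁ , v₁≢v₂ , v₀≢v₂ , a₀₁ , a₁₂ , a₂₀ , n₁₀ , n₂₁ , n₀₂) =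
  Triangle.usefulNeighbourOrArc G v₀ v₁ v₂ v₀≢v₁ v₁≢v₂ v₀≢v₂ a₀₁ a₁₂ a₂₀ n₁₀ n₂₁ n₀₂ irreducible G∈Ω
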